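{- Let $\mathcal{R}=(\mathcal{F},\Pi,\mu,E,H,R)$ be an EGTRS. Then $\to_{\mathcal{R},E}$ is locally confluent modulo $E$ with $\to_{\mathcal{R}}$ if and only if all conditional pairs in $\mathsf{LCCP}(\mathcal{R})\cup\mathsf{CVP}^{\to_{ps}}(\mathcal{R})\cup\mathsf{DCP}(\mathcal{R})$ are joinable modulo $E$ with $\to_{\mathcal{R},E}$.
   Context: An EGTRS $\mathcal{R}=(\mathcal{F},\Pi,\mu,E,H,R)$ consists of a signature $\mathcal{F}$ of function symbols, a signature $\Pi$ of predicate symbols containing $=,\to,\to^*$, a replacement map $\mu$ (selecting the active, i.e. rewritable, argument positions of each function symbol), a set $E$ of conditional equations $s=t\Leftarrow c$, a set $H$ of definite Horn clauses $A\Leftarrow c$ whose head predicate is not $=,\to,\to^*$, and a set $R$ of conditional rules $\ell\to r\Leftarrow c$ with $\ell$ not a variable ($c$ always a sequence of atoms); the equality predicate is assumed not to depend on $R$. $R^{rm}$ is $R$ with conditions of the form $s\approx t$ reinterpreted via rewriting modulo $E$. The relations are: $s=_E t$ ($E$-equality); $s\to_{\mathcal{R}} t$ (written for $\to_{\mathcal{R}^{rm}}$) iff there are an active position $p$ of $s$, a rule $\ell\to r\Leftarrow c$ in $R^{rm}$ and a substitution $\sigma$ with $s|_p=\sigma(\ell)$, all atoms of $\sigma(c)$ deducible (conditions being evaluated using rewriting modulo $\to_{\mathcal{R}/E}$), and $t=s[\sigma(r)]_p$; $s\to_{\mathcal{R},E}t$ (Peterson–Stickel rewriting, also denoted $\to_{ps}$)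 is defined the same way but with $s|_p=_E\sigma(\ell)$; $\to_{\mathcal{R}/E}={=_E}\circ\to_{\mathcal{R}}\circ{=_E}$. $\overleftrightarrow{E}$ denotes the rules obtained by orienting the equations of $E$ both ways. A conditional pair $\langle s,t\rangle\Leftarrow c$ is feasible if some substitution satisfies all atoms of $c$; it is joinable modulo $E$ with a relation $\to$ if for every substitution $\sigma$ satisfying $c$ there are $u,u'$ with $\sigma(s)\to^*u$, $\sigma(t)\to^*u'$ and $u=_E u'$. $\mathsf{LCCP}(\mathcal{R})$ is the set of feasible pairs $\langle \ell[r']_p,r\rangle\Leftarrow \ell|_p=\ell',c,c'$ for variable-disjoint rules $\ell\to r\Leftarrow c$, $\ell'\to r'\Leftarrow c'$ in $R^{rm}$ and an active non-variable position $p$ of $\ell$. $\mathsf{CVP}^{\to_{ps}}(\mathcal{R})$ is the set of feasible pairs $\langle \ell[x']_p,r\rangle\Leftarrow x\to_{ps}x',c$ for a rule $\ell\to r\Leftarrow c$ in $R^{rm}$, an active variable $x$ of $\ell$, an active position $p$ of $x$ in $\ell$ and a fresh variable $x'$. $\mathsf{DCP}(\mathcal{R})$ is the set of feasible pairs $\langle r,x'\rangle\Leftarrow x=\ell, x\to_{inner}x',c$ for a rule $\ell\to r\Leftarrow c$ in $R^{rm}$, with $x,x'$ fresh variables and $\to_{inner}$ a non-root $\to_{\mathcal{R}}$-step. $\to_{\mathcal{R},E}$ is locally confluent modulo $E$ with $\to_{\mathcal{R}}$ iff for all $t,t',t''$, if $t\to_{\mathcal{R},E}t'$ and $t\to_{\mathcal{R}}t''$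 then there are $u,u'$ with $t'\to^*_{\mathcal{R},E}u$, $t''\to^*_{\mathcal{R},E}u'$ and $u=_E u'$. -}

module Defs where

open import Data.Empty using (⊥)
open import Data.Unit using (⊤)
open import Data.Nat using (ℕ; zero; suc; _⊔_; _+_)
open import Data.Fin using (Fin)
open import Data.Vec using (Vec; []; _∷_; lookup; _[_]≔_)
open import Data.Vec.Relation.Binary.Pointwise.Inductive using (Pointwise)
open import Data.List using (List; []; _∷_; map; _++_)
open import Data.List.Relation.Unary.All using (All)
open import Data.List.Relation.Unary.Any using (Any)
open import Data.Bool using (Bool; true)
open import Data.Product using (Σ; ∃; ∃₂; _×_; _,_)
open import Data.Sum using (_⊎_)
open import Relation.Binary.PropositionalEquality using (_≡_; _≢_)
open import Relation.Binary.Construct.Closure.ReflexiveTransitive using (Star)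
open import Relation.Nullary using (¬_)

-- Signatures: function symbols F with arities, and the user predicate
-- symbols of Π (Π = these together with the built-in =, →, →*).

record Signature : Set₁ where
  field
    Fun  : Set
    ar   : Fun → ℕ
    PSym : Set
    par  : PSym → ℕ

module Syntax (Sg : Signature) where
  open Signature Sg

  data Term : Set where
    var : ℕ → Term
    fun : (f : Fun) → Vec Term (ar f) → Term

  Subst : Set
  Subst = ℕ → Term

  mutual
    _·_ : Subst → Term → Term
    σ · var x    = σ x
    σ · fun f ts = fun f (σ ·ᵛ ts)

    _·ᵛ_ : ∀ {n} → Subst → Vec Term n → Vec Term n
    σ ·ᵛ []       = []
    σ ·ᵛ (t ∷ ts) = (σ · t) ∷ (σ ·ᵛ ts)

  data Atom : Set where
    _≐_  : Term → Term → Atom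
    _⇒_  : Term → Term → Atom
    _⇒*_ : Term → Term → Atom
    pr   : (P : PSym) → Vec Term (par P) → Atom

  Cond : Set
  Cond = List Atom

  substA : Subst → Atom → Atom
  substA σ (s ≐ t)   = (σ · s) ≐ (σ · t)
  substA σ (s ⇒ t)   = (σ · s) ⇒ (σ · t)
  substA σ (s ⇒* t)  = (σ · s) ⇒* (σ · t)
  substA σ (pr P ts) = pr P (σ ·ᵛ ts)

  substC : Subst → Cond → Cond
  substC σ = map (substA σ)

  -- largest variable index occurring (used to pick fresh variables)
  mutual
    mvT : Term → ℕ
    mvT (var x)    = x
    mvT (fun f ts) = mvV ts

    mvV : ∀ {n} → Vec Term n → ℕ
    mvV []       = 0
    mvV (t ∷ ts) = mvT t ⊔ mvV ts

  mvA : Atom → ℕ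
  mvA (s ≐ t)   = mvT s ⊔ mvT t
  mvA (s ⇒ t)   = mvT s ⊔ mvT t
  mvA (s ⇒* t)  = mvT s ⊔ mvT t
  mvA (pr P ts) = mvV ts

  mvC : Cond → ℕ
  mvC []       = 0
  mvC (a ∷ c)  = mvA a ⊔ mvC c

  data Pos : Term → Set where
    here  : ∀ {t} → Pos t
    there : ∀ {f ts} (i : Fin (ar f)) → Pos (lookup ts i) → Pos (fun f ts)

  _∣_ : (t : Term) → Pos t → Term
  t ∣ here                = t
  fun f ts ∣ there i p    = lookup ts i ∣ p

  _[_]at_ : (t : Term) → Term → Pos t → Term
  t [ u ]at here               = u
  fun f ts [ u ]at there i p   = fun f (ts [ i ]≔ (lookup ts i [ u ]at p))

  NonRoot : ∀ {t} → Pos t → Set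
  NonRoot here        = ⊥
  NonRoot (there i p) = ⊤

  IsVar : Term → Set
  IsVar t = ∃ λ x → t ≡ var x

  record CEq : Set where
    constructor _≐_⇐_
    field
      eql eqr : Term
      eqc     : Cond

  record Horn : Set where
    field
      hpred : PSym
      hargs : Vec Term (par hpred)
      hcond : Cond

  record Rule : Set where
    field
      lhs        : Term
      rhs        : Term
      cond       : Cond
      lhs-nonvar : ¬ IsVar lhs

  mvRule : Rule → ℕ
  mvRule ρ = mvT (Rule.lhs ρ) ⊔ mvT (Rule.rhs ρ) ⊔ mvC (Rule.cond ρ)

  record EGTRS : Set₁ where
    field
      μ : (f : Fun) → Fin (ar f) → Bool
      E : CEq → Set
      H : Horn → Set
      R : Rule → Set

  data Active (𝓡 : EGTRS) : ∀ {t} → Pos t → Set where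
    here  : ∀ {t} → Active 𝓡 (here {t})
    there : ∀ {f ts} (i : Fin (ar f)) {p : Pos (lookup ts i)} →
            EGTRS.μ 𝓡 f i ≡ true → Active 𝓡 p → Active 𝓡 (there {f} {ts} i p)

  data PKind : Set where
    kEq kRew kRews : PKind
    kUser : PSym → PKind

  kindOf : Atom → PKind
  kindOf (_ ≐ _)  = kEq
  kindOf (_ ⇒ _)  = kRew
  kindOf (_ ⇒* _) = kRews
  kindOf (pr P _) = kUser P

  OccursIn : PKind → Cond → Set
  OccursIn k c = Any (λ a → kindOf a ≡ k) c

  data EqDep (𝓡 : EGTRS) (k : PKind) : Set where
    viaE : (e : CEq) → EGTRS.E 𝓡 e → OccursIn k (CEq.eqc e) → EqDep 𝓡 k
    viaH : (h : Horn) → EGTRS.H 𝓡 h → EqDep 𝓡 (kUser (Horn.hpred h)) →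
           OccursIn k (Horn.hcond h) → EqDep 𝓡 k

  EqIndependentOfR : EGTRS → Set
  EqIndependentOfR 𝓡 = ¬ EqDep 𝓡 kRew × ¬ EqDep 𝓡 kRews

  -- Semantics of 𝓡 (conditions read as in R^rm: → and →* in conditions
  -- mean →_{R/E} and →*_{R/E}, = means =_E)
  module Semantics (𝓡 : EGTRS) where
    open EGTRS 𝓡
    open Rule

    mutual
      data _=E_ : Term → Term → Set where
        =refl  : ∀ {t} → t =E t
        =sym   : ∀ {s t} → s =E t → t =E s
        =trans : ∀ {s t u} → s =E t → t =E u → s =E u
        =cong  : ∀ f {ss ts : Vec Term (ar f)} →
                 Pointwise _=E_ ss ts → fun f ss =E fun f ts
        =eqn   : (e : CEq) → E e → (σ : Subst) →
                 All Holds (substC σ (CEq.eqc e)) →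
                 (σ · CEq.eql e) =E (σ · CEq.eqr e)

      data StepAt : (s : Term) → Pos s → Term → Set where
        step : ∀ {s} (p : Pos s) → Active 𝓡 p → (ρ : Rule) → R ρ →
               (σ : Subst) → s ∣ p ≡ σ · lhs ρ →
               All Holds (substC σ (cond ρ)) →
               StepAt s p (s [ σ · rhs ρ ]at p)

      data Holds : Atom → Set where
        h-eq    : ∀ {s t} → s =E t → Holds (s ≐ t)
        h-step  : ∀ {s s' t' t} {p : Pos s'} →
                  s =E s' → StepAt s' p t' → t' =E t → Holds (s ⇒ t)
        h-steps : ∀ {s t} → StepsRE s t → Holds (s ⇒* t)
        h-horn  : (h : Horn) → H h → (σ : Subst) →
                  All Holds (substC σ (Horn.hcond h)) →
                  Holds (pr (Horn.hpred h) (σ ·ᵛ Horn.hargs h))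

      data StepsRE : Term → Term → Set where
        none : ∀ {t} → StepsRE t t
        more : ∀ {s t u} → Holds (s ⇒ t) → StepsRE t u → StepsRE s u

    _⟶_ : Term → Term → Set
    s ⟶ t = Σ (Pos s) λ p → StepAt s p t

    _⟶inner_ : Term → Term → Set
    s ⟶inner t = Σ (Pos s) λ p → NonRoot p × StepAt s p t

    data _⟶ps_ : Term → Term → Set where
      ps : ∀ {s} (p : Pos s) → Active 𝓡 p → (ρ : Rule) → R ρ →
           (σ : Subst) → (s ∣ p) =E (σ · lhs ρ) →
           All Holds (substC σ (cond ρ)) →
           s ⟶ps (s [ σ · rhs ρ ]at p)

    _⟶ps*_ : Term → Term → Set
    _⟶ps*_ = Star _⟶ps_

    LocallyConfluentModE : Set
    LocallyConfluentModE = ∀ t t' t'' → t ⟶ps t' → t ⟶ t'' →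
      ∃₂ λ u u' → (t' ⟶ps* u) × (t'' ⟶ps* u') × (u =E u')

    data CAtom : Set where
      plain  : Atom → CAtom
      psA    : Term → Term → CAtom
      innerA : Term → Term → CAtom

    record CPair : Set where
      constructor ⟨_,_⟩⇐_
      field
        left right : Term
        pcond      : List CAtom

    SatA : Subst → CAtom → Set
    SatA σ (plain a)    = Holds (substA σ a)
    SatA σ (psA s t)    = (σ · s) ⟶ps (σ · t)
    SatA σ (innerA s t) = (σ · s) ⟶inner (σ · t)

    Satisfies : Subst → CPair → Set
    Satisfies σ π = All (SatA σ) (CPair.pcond π)

    Feasible : CPair → Set
    Feasible π = ∃ λ σ → Satisfies σ π

    JoinableModE-ps : CPair → Set
    JoinableModE-ps π = ∀ σ → Satisfies σ π →
      ∃₂ λ u u' → ((σ · CPair.left π) ⟶ps* u) ×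
                  ((σ · CPair.right π) ⟶ps* u') × (u =E u')

    -- LCCP: ρ' is renamed apart from ρ by shifting its variables
    shift : ℕ → Subst
    shift k x = var (k + x)

    lccpPair : (ρ ρ' : Rule) → Pos (lhs ρ) → CPair
    lccpPair ρ ρ' p =
      let θ = shift (suc (mvRule ρ)) in
      ⟨ lhs ρ [ θ · rhs ρ' ]at p , rhs ρ ⟩⇐
        (plain ((lhs ρ ∣ p) ≐ (θ · lhs ρ')) ∷
           map plain (cond ρ ++ substC θ (cond ρ')))

    data InLCCP : CPair → Set where
      lccp : (ρ ρ' : Rule) → R ρ → R ρ' → (p : Pos (lhs ρ)) →
             Active 𝓡 p → ¬ IsVar (lhs ρ ∣ p) →
             Feasible (lccpPair ρ ρ' p) → InLCCP (lccpPair ρ ρ' p)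

    cvpPair : (ρ : Rule) → ℕ → Pos (lhs ρ) → CPair
    cvpPair ρ x p =
      let x' = suc (mvRule ρ) in
      ⟨ lhs ρ [ var x' ]at p , rhs ρ ⟩⇐
        (psA (var x) (var x') ∷ map plain (cond ρ))

    data InCVP : CPair → Set where
      cvp : (ρ : Rule) → R ρ → (x : ℕ) → (p : Pos (lhs ρ)) →
            Active 𝓡 p → lhs ρ ∣ p ≡ var x →
            Feasible (cvpPair ρ x p) → InCVP (cvpPair ρ x p)

    dcpPair : Rule → CPair
    dcpPair ρ =
      let k = suc (mvRule ρ) in
      ⟨ rhs ρ , var (suc k) ⟩⇐
        (plain (var k ≐ lhs ρ) ∷ innerA (var k) (var (suc k)) ∷
           map plain (cond ρ))

    data InDCP : CPair → Set where
      dcp : (ρ : Rule) → R ρ → Feasible (dcpPair ρ) → InDCP (dcpPair ρ)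

    AllPairsJoinable : Set
    AllPairsJoinable = ∀ π → (InLCCP π ⊎ InCVP π ⊎ InDCP π) →
                       JoinableModE-ps π

{-# OPTIONS --safe #-}
module Submission where

-- A peak t' ←ps t → t'' is analysed by the positions of its two steps. If the
-- R-step is at the root, t is an instance of its left-hand side ℓ, and the
-- Peterson–Stickel step either rewrites at a non-variable position of ℓ (an
-- instance of an LCCP pair) or inside the instance of a variable of ℓ (an
-- instance of the CVP pair, whose condition x →ps x' records that very step, so
-- no linearity is needed). If the Peterson–Stickel step is at the root and the
-- R-step below it, the peak is an instance of the DCP pair of the rule. Steps in
-- the same argument are handled by induction, steps in different arguments
-- commute. Conversely, every satisfying instance of a pair is such a peak.

open import Defs
open import Function.Bundles using (_⇔_; mk⇔)
open import Function using (_∘_)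
open import Data.Unit using (tt)
open import Data.Nat using (ℕ; zero; suc; _+_; _∸_; _≤_; _≤?_)
open import Data.Nat.Properties
  using (≤-refl; <⇒≱; m≤m+n; m≤n+m; m+n∸m≡n; m+n∸n≡m; m⊔n≤o⇒m≤o; m⊔n≤o⇒n≤o)
open import Data.Fin using (Fin; zero; suc; _≟_)
open import Data.Vec using (Vec; []; _∷_; lookup; _[_]≔_)
open import Data.Vec.Properties
  using (lookup∘update; lookup∘update′; []≔-idempotent; []≔-commutes)
open import Data.Vec.Relation.Binary.Pointwise.Inductive as Pointwise
  using (Pointwise; _∷_)
open import Data.List using ([]; _∷_; map; _++_)
open import Data.List.Properties using (map-++)
open import Data.List.Relation.Unary.All using (All; _∷_)
import Data.List.Relation.Unary.All.Properties as All
open import Data.Bool using (true)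
open import Data.Product using (Σ; ∃₂; _×_; _,_; proj₁; proj₂)
open import Data.Sum using (inj₁; inj₂)
open import Relation.Binary.PropositionalEquality
  using (_≡_; refl; sym; trans; cong; cong₂; subst; subst₂)
open import Relation.Binary.Construct.Closure.ReflexiveTransitive using (ε; _◅_)
open import Relation.Nullary using (¬_; yes; no; contradiction)

module Substitutions (Sg : Signature) where
  open Signature Sg
  open Syntax Sg
  open Rule

  fun-injective : ∀ {f} {ss ts : Vec Term (ar f)} → fun f ss ≡ fun f ts → ss ≡ ts
  fun-injective refl = refl

  lookup-·ᵛ : ∀ {n} σ (ts : Vec Term n) i → lookup (σ ·ᵛ ts) i ≡ σ · lookup ts i
  lookup-·ᵛ σ (t ∷ ts) zero    = refl
  lookup-·ᵛ σ (t ∷ ts) (suc i) = lookup-·ᵛ σ ts i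

  ·ᵛ-[]≔ : ∀ {n} σ (ts : Vec Term n) i u → σ ·ᵛ (ts [ i ]≔ u) ≡ (σ ·ᵛ ts) [ i ]≔ (σ · u)
  ·ᵛ-[]≔ σ (t ∷ ts) zero    u = refl
  ·ᵛ-[]≔ σ (t ∷ ts) (suc i) u = cong (σ · t ∷_) (·ᵛ-[]≔ σ ts i u)

  _∘ₛ_ : Subst → Subst → Subst
  (σ ∘ₛ θ) x = σ · θ x

  mutual
    ·-∘ₛ : ∀ σ θ t → σ · (θ · t) ≡ (σ ∘ₛ θ) · t
    ·-∘ₛ σ θ (var x)    = refl
    ·-∘ₛ σ θ (fun f ts) = cong (fun f) (·ᵛ-∘ₛ σ θ ts)

    ·ᵛ-∘ₛ : ∀ σ θ {n} (ts : Vec Term n) → σ ·ᵛ (θ ·ᵛ ts) ≡ (σ ∘ₛ θ) ·ᵛ ts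
    ·ᵛ-∘ₛ σ θ []       = refl
    ·ᵛ-∘ₛ σ θ (t ∷ ts) = cong₂ _∷_ (·-∘ₛ σ θ t) (·ᵛ-∘ₛ σ θ ts)

  substA-∘ₛ : ∀ σ θ a → substA σ (substA θ a) ≡ substA (σ ∘ₛ θ) a
  substA-∘ₛ σ θ (s ≐ t)   = cong₂ _≐_ (·-∘ₛ σ θ s) (·-∘ₛ σ θ t)
  substA-∘ₛ σ θ (s ⇒ t)   = cong₂ _⇒_ (·-∘ₛ σ θ s) (·-∘ₛ σ θ t)
  substA-∘ₛ σ θ (s ⇒* t)  = cong₂ _⇒*_ (·-∘ₛ σ θ s) (·-∘ₛ σ θ t)
  substA-∘ₛ σ θ (pr P ts) = cong (pr P) (·ᵛ-∘ₛ σ θ ts)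

  substC-∘ₛ : ∀ σ θ c → substC σ (substC θ c) ≡ substC (σ ∘ₛ θ) c
  substC-∘ₛ σ θ []      = refl
  substC-∘ₛ σ θ (a ∷ c) = cong₂ _∷_ (substA-∘ₛ σ θ a) (substC-∘ₛ σ θ c)

  AgreeUpTo : ℕ → Subst → Subst → Set
  AgreeUpTo m σ τ = ∀ x → x ≤ m → σ x ≡ τ x

  mutual
    agree-· : ∀ {m σ τ} t → mvT t ≤ m → AgreeUpTo m σ τ → σ · t ≡ τ · t
    agree-· (var x)    le h = h x le
    agree-· (fun f ts) le h = cong (fun f) (agree-·ᵛ ts le h)

    agree-·ᵛ : ∀ {m σ τ n} (ts : Vec Term n) → mvV ts ≤ m → AgreeUpTo m σ τ → σ ·ᵛ ts ≡ τ ·ᵛ ts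
    agree-·ᵛ []       le h = refl
    agree-·ᵛ (t ∷ ts) le h =
      cong₂ _∷_ (agree-· t (m⊔n≤o⇒m≤o _ _ le) h) (agree-·ᵛ ts (m⊔n≤o⇒n≤o _ _ le) h)

  agree-substA : ∀ {m σ τ} a → mvA a ≤ m → AgreeUpTo m σ τ → substA σ a ≡ substA τ a
  agree-substA (s ≐ t)   le h = cong₂ _≐_ (agree-· s (m⊔n≤o⇒m≤o _ _ le) h) (agree-· t (m⊔n≤o⇒n≤o _ _ le) h)
  agree-substA (s ⇒ t)   le h = cong₂ _⇒_ (agree-· s (m⊔n≤o⇒m≤o _ _ le) h) (agree-· t (m⊔n≤o⇒n≤o _ _ le) h)
  agree-substA (s ⇒* t)  le h = cong₂ _⇒*_ (agree-· s (m⊔n≤o⇒m≤o _ _ le) h) (agree-· t (m⊔n≤o⇒n≤o _ _ le) h)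
  agree-substA (pr P ts) le h = cong (pr P) (agree-·ᵛ ts le h)

  agree-substC : ∀ {m σ τ} c → mvC c ≤ m → AgreeUpTo m σ τ → substC σ c ≡ substC τ c
  agree-substC []      le h = refl
  agree-substC (a ∷ c) le h =
    cong₂ _∷_ (agree-substA a (m⊔n≤o⇒m≤o _ _ le) h) (agree-substC c (m⊔n≤o⇒n≤o _ _ le) h)

  ·-lookup : ∀ {σ τ f} (ts : Vec Term (ar f)) i → σ · fun f ts ≡ τ · fun f ts →
             σ · lookup ts i ≡ τ · lookup ts i
  ·-lookup {σ} {τ} ts i eq =
    trans (sym (lookup-·ᵛ σ ts i)) (trans (cong (λ us → lookup us i) (fun-injective eq)) (lookup-·ᵛ τ ts i))

  ·-∣ : ∀ {σ τ} l (p : Pos l) → σ · l ≡ τ · l → σ · (l ∣ p) ≡ τ · (l ∣ p)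
  ·-∣ l          here        eq = eq
  ·-∣ (fun f ts) (there i p) eq = ·-∣ (lookup ts i) p (·-lookup ts i eq)

  -- σ · l with its subterm at p replaced by w; p is a position of l, not of σ · l.
  replaceAt : Subst → (l : Term) → Pos l → Term → Term
  replaceAt σ l          here        w = w
  replaceAt σ (fun f ts) (there i p) w = fun f ((σ ·ᵛ ts) [ i ]≔ replaceAt σ (lookup ts i) p w)

  ·-[]at : ∀ {σ τ} l (p : Pos l) v → τ · l ≡ σ · l → τ · (l [ v ]at p) ≡ replaceAt σ l p (τ · v)
  ·-[]at l          here        v eq = refl
  ·-[]at {σ} {τ} (fun f ts) (there i p) v eq =
    cong (fun f) (trans (·ᵛ-[]≔ τ ts i _)
      (cong₂ (λ us u → us [ i ]≔ u) (fun-injective eq) (·-[]at (lookup ts i) p v (·-lookup ts i eq))))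

  -- The renaming apart in lccpPair and the fresh variables of cvpPair and dcpPair
  -- all lie above mvRule ρ; extend ρ σ b instantiates them by b.
  extend : Rule → Subst → Subst → Subst
  extend ρ σ b x with x ≤? mvRule ρ
  ... | yes _ = σ x
  ... | no  _ = b (x ∸ suc (mvRule ρ))

  module _ (ρ : Rule) (σ b : Subst) where
    private
      m = mvRule ρ

    extend-agrees : AgreeUpTo m (extend ρ σ b) σ
    extend-agrees x x≤m with x ≤? m
    ... | yes _   = refl
    ... | no  x≰m = contradiction x≤m x≰m

    extend-above : ∀ x → ¬ x ≤ m → extend ρ σ b x ≡ b (x ∸ suc m)
    extend-above x x≰m with x ≤? m
    ... | yes x≤m = contradiction x≤m x≰m
    ... | no  _   = refl

    -- y + suc m rather than suc m + y, so that y = 0, 1 are the variables suc m, suc (suc m).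
    extend-fresh : ∀ y → extend ρ σ b (y + suc m) ≡ b y
    extend-fresh y = trans (extend-above _ (<⇒≱ (m≤n+m (suc m) y))) (cong b (m+n∸n≡m y (suc m)))

    extend-shifted : ∀ y → extend ρ σ b (suc m + y) ≡ b y
    extend-shifted y = trans (extend-above _ (<⇒≱ (m≤m+n (suc m) y))) (cong b (m+n∸m≡n (suc m) y))

    extend-lhs : extend ρ σ b · lhs ρ ≡ σ · lhs ρ
    extend-lhs = agree-· (lhs ρ) (m⊔n≤o⇒m≤o _ _ (m⊔n≤o⇒m≤o _ _ ≤-refl)) extend-agrees

    extend-rhs : extend ρ σ b · rhs ρ ≡ σ · rhs ρ
    extend-rhs = agree-· (rhs ρ) (m⊔n≤o⇒n≤o (mvT (lhs ρ)) _ (m⊔n≤o⇒m≤o _ (mvC (cond ρ)) ≤-refl)) extend-agrees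

    extend-cond : substC (extend ρ σ b) (cond ρ) ≡ substC σ (cond ρ)
    extend-cond = agree-substC (cond ρ) (m⊔n≤o⇒n≤o _ _ ≤-refl) extend-agrees

module _ (Sg : Signature) (𝓡 : Syntax.EGTRS Sg) where
  open Signature Sg
  open Syntax Sg
  open EGTRS 𝓡 using (μ; R)
  open Substitutions Sg
  open Semantics 𝓡
  open Rule

  module _ (ρ : Rule) (σ b : Subst) where
    private
      τ = extend ρ σ b
      θ = shift (suc (mvRule ρ))

    extend-renamed : ∀ t → τ · (θ · t) ≡ b · t
    extend-renamed t = trans (·-∘ₛ τ θ t) (agree-· t ≤-refl (λ y _ → extend-shifted ρ σ b y))

    extend-renamedC : ∀ c → substC τ (substC θ c) ≡ substC b c
    extend-renamedC c = trans (substC-∘ₛ τ θ c) (agree-substC c ≤-refl (λ y _ → extend-shifted ρ σ b y))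

  ≡⇒=E : ∀ {s t} → s ≡ t → s =E t
  ≡⇒=E refl = =refl

  pointwise-[]≔ : ∀ {n} (ts : Vec Term n) i {a b} → a =E b → Pointwise _=E_ (ts [ i ]≔ a) (ts [ i ]≔ b)
  pointwise-[]≔ (t ∷ ts) zero    a=b = a=b ∷ Pointwise.refl =refl
  pointwise-[]≔ (t ∷ ts) (suc i) a=b = =refl ∷ pointwise-[]≔ ts i a=b

  plain⁺ : ∀ {τ} c → All Holds (substC τ c) → All (SatA τ) (map plain c)
  plain⁺ c h = All.map⁺ (All.map⁻ h)

  plain⁻ : ∀ {τ} c → All (SatA τ) (map plain c) → All Holds (substC τ c)
  plain⁻ {τ} c h = All.map⁺ {f = substA τ} (All.map⁻ h)

  holds-++⁺ : ∀ {τ} c d → All Holds (substC τ c) → All Holds (substC τ d) → All Holds (substC τ (c ++ d))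
  holds-++⁺ {τ} c d hc hd = subst (All Holds) (sym (map-++ (substA τ) c d)) (All.++⁺ hc hd)

  holds-++⁻ : ∀ {τ} c d → All Holds (substC τ (c ++ d)) → All Holds (substC τ c) × All Holds (substC τ d)
  holds-++⁻ {τ} c d h = All.++⁻ (substC τ c) (subst (All Holds) (map-++ (substA τ) c d) h)

  RootStep : (Term → Term → Set) → Term → Term → Set
  RootStep _≈_ s t = Σ Rule λ ρ → R ρ × Σ Subst λ σ →
    (s ≈ (σ · lhs ρ)) × All Holds (substC σ (cond ρ)) × (t ≡ σ · rhs ρ)

  -- Steps as an inductive closure, so that peaks are analysed by recursion on both steps.
  data ActiveClosure (_↝_ : Term → Term → Set) : Term → Term → Set where
    root : ∀ {s t} → s ↝ t → ActiveClosure _↝_ s t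
    arg  : ∀ {f ts u} (i : Fin (ar f)) → μ f i ≡ true → ActiveClosure _↝_ (lookup ts i) u →
           ActiveClosure _↝_ (fun f ts) (fun f (ts [ i ]≔ u))

  atPosition : ∀ {_≈_ s w} (p : Pos s) → Active 𝓡 p → RootStep _≈_ (s ∣ p) w →
               ActiveClosure (RootStep _≈_) s (s [ w ]at p)
  atPosition        here        here           rs = root rs
  atPosition {_≈_} (there i p) (there _ μi a) rs = arg i μi (atPosition {_≈_} p a rs)

  ps⇒closure : ∀ {s t} → s ⟶ps t → ActiveClosure (RootStep _=E_) s t
  ps⇒closure (ps p a ρ r σ e c) = atPosition {_=E_} p a (ρ , r , σ , e , c , refl)

  closure⇒ps : ∀ {s t} → ActiveClosure (RootStep _=E_) s t → s ⟶ps t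
  closure⇒ps (root (ρ , r , σ , e , c , refl)) = ps here here ρ r σ e c
  closure⇒ps (arg i μi d) with closure⇒ps d
  ... | ps p a ρ r σ e c = ps (there i p) (there i μi a) ρ r σ e c

  step⇒closure : ∀ {s t} → s ⟶ t → ActiveClosure (RootStep _≡_) s t
  step⇒closure (p , step _ a ρ r σ e c) = atPosition {_≡_} p a (ρ , r , σ , e , c , refl)

  closure⇒step : ∀ {s t} → ActiveClosure (RootStep _≡_) s t → s ⟶ t
  closure⇒step (root (ρ , r , σ , e , c , refl)) = here , step here here ρ r σ e c
  closure⇒step (arg i μi d) with closure⇒step d
  ... | p , step _ a ρ r σ e c = there i p , step (there i p) (there i μi a) ρ r σ e c

  step⇒ps : ∀ {s t} → s ⟶ t → s ⟶ps t
  step⇒ps (p , step _ a ρ r σ e c) = ps p a ρ r σ (≡⇒=E e) c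

  arg⇒inner : ∀ {f ts u} (i : Fin (ar f)) → μ f i ≡ true → ActiveClosure (RootStep _≡_) (lookup ts i) u →
              fun f ts ⟶inner fun f (ts [ i ]≔ u)
  arg⇒inner i μi d with closure⇒step d
  ... | p , step _ a ρ r σ e c = there i p , tt , step (there i p) (there i μi a) ρ r σ e c

  ps-arg : ∀ {f} {i : Fin (ar f)} → μ f i ≡ true → ∀ ts {a b} → lookup ts i ≡ a → a ⟶ps b →
           fun f ts ⟶ps fun f (ts [ i ]≔ b)
  ps-arg {i = i} μi ts refl s = closure⇒ps (arg i μi (ps⇒closure s))

  ps*-arg : ∀ {f} {i : Fin (ar f)} → μ f i ≡ true → ∀ ts {a b} → a ⟶ps* b →
            fun f (ts [ i ]≔ a) ⟶ps* fun f (ts [ i ]≔ b)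
  ps*-arg μi ts ε = ε
  ps*-arg {f} {i} μi ts {a} (s ◅ ss) =
    ps-arg μi (ts [ i ]≔ a) (lookup∘update i ts a) s
    ◅ subst (λ us → fun f us ⟶ps* _) (sym ([]≔-idempotent ts i)) (ps*-arg μi ts ss)

  ps-instance : ∀ σ l (p : Pos l) → Active 𝓡 p → ∀ {v} →
                ActiveClosure (RootStep _=E_) (σ · (l ∣ p)) (σ · v) → (σ · l) ⟶ps (σ · (l [ v ]at p))
  ps-instance σ l p a {v} d =
    subst ((σ · l) ⟶ps_) (sym (·-[]at l p v refl)) (closure⇒ps (lift l p a d))
    where
    lift : ∀ l (p : Pos l) → Active 𝓡 p → ∀ {w} →
           ActiveClosure (RootStep _=E_) (σ · (l ∣ p)) w → ActiveClosure (RootStep _=E_) (σ · l) (replaceAt σ l p w)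
    lift l          here        here           d = d
    lift (fun f ts) (there i p) (there _ μi a) {w} d =
      arg i μi (subst (λ s → ActiveClosure (RootStep _=E_) s (replaceAt σ (lookup ts i) p w))
                      (sym (lookup-·ᵛ σ ts i)) (lift (lookup ts i) p a d))

  data StepInInstance (σ : Subst) (l : Term) (w : Term) : Set where
    atNonVariable : (p : Pos l) → Active 𝓡 p → ¬ IsVar (l ∣ p) →
                    ∀ {w₀} → RootStep _=E_ (σ · (l ∣ p)) w₀ → w ≡ replaceAt σ l p w₀ → StepInInstance σ l w
    belowVariable : (p : Pos l) → Active 𝓡 p → ∀ x → l ∣ p ≡ var x →
                    ∀ {w₁} → σ x ⟶ps w₁ → w ≡ replaceAt σ l p w₁ → StepInInstance σ l w

  stepInInstance-arg : ∀ {σ f ts u} (i : Fin (ar f)) → μ f i ≡ true → StepInInstance σ (lookup ts i) u →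
                       StepInInstance σ (fun f ts) (fun f ((σ ·ᵛ ts) [ i ]≔ u))
  stepInInstance-arg i μi (atNonVariable p a nv s refl)   = atNonVariable (there i p) (there i μi a) nv s refl
  stepInInstance-arg i μi (belowVariable p a x eq s refl) = belowVariable (there i p) (there i μi a) x eq s refl

  mutual
    stepInInstance : ∀ σ l {w} → ActiveClosure (RootStep _=E_) (σ · l) w → StepInInstance σ l w
    stepInInstance σ (var x)    d            = belowVariable here here x refl (closure⇒ps d) refl
    stepInInstance σ (fun f ts) (root s)     = atNonVariable here here (λ { (_ , ()) }) s refl
    stepInInstance σ (fun f ts) (arg i μi d) = stepInInstance-arg i μi (stepInInstance-lookup σ ts i d)

    stepInInstance-lookup : ∀ σ {n} (ts : Vec Term n) i {u} →
                            ActiveClosure (RootStep _=E_) (lookup (σ ·ᵛ ts) i) u → StepInInstance σ (lookup ts i) u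
    stepInInstance-lookup σ (t ∷ ts) zero    d = stepInInstance σ t d
    stepInInstance-lookup σ (t ∷ ts) (suc i) d = stepInInstance-lookup σ ts i d

  Joinable : Term → Term → Set
  Joinable s t = ∃₂ λ u u' → (s ⟶ps* u) × (t ⟶ps* u') × (u =E u')

  joinable-arg : ∀ {f} {i : Fin (ar f)} → μ f i ≡ true → ∀ ts {a b} → Joinable a b →
                 Joinable (fun f (ts [ i ]≔ a)) (fun f (ts [ i ]≔ b))
  joinable-arg {f} {i} μi ts (u , u' , a↠u , b↠u' , u=u') =
    fun f (ts [ i ]≔ u) , fun f (ts [ i ]≔ u') , ps*-arg μi ts a↠u , ps*-arg μi ts b↠u' ,
    =cong f (pointwise-[]≔ ts i u=u')

  joinable-disjoint : ∀ {f} ts {i j : Fin (ar f)} → μ f i ≡ true → μ f j ≡ true → ¬ i ≡ j → ∀ {a b} →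
                      lookup ts i ⟶ps a → lookup ts j ⟶ps b →
                      Joinable (fun f (ts [ i ]≔ a)) (fun f (ts [ j ]≔ b))
  joinable-disjoint {f} ts {i} {j} μi μj i≢j {a} {b} sa sb =
    fun f ((ts [ i ]≔ a) [ j ]≔ b) , fun f ((ts [ j ]≔ b) [ i ]≔ a) ,
    ps-arg μj (ts [ i ]≔ a) (lookup∘update′ (i≢j ∘ sym) ts a) sb ◅ ε ,
    ps-arg μi (ts [ j ]≔ b) (lookup∘update′ i≢j ts b) sa ◅ ε ,
    ≡⇒=E (cong (fun f) ([]≔-commutes ts i j i≢j))

  lccp-joinable : LocallyConfluentModE → ∀ π → InLCCP π → JoinableModE-ps π
  lccp-joinable lc _ (lccp ρ ρ' r r' p a _ _) σ (h-eq overlaps ∷ conds) =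
    lc (σ · lhs ρ) _ (σ · rhs ρ) (ps-instance σ (lhs ρ) p a (root inner)) (here , step here here ρ r σ refl c)
    where
    θ = shift (suc (mvRule ρ))
    split = holds-++⁻ (cond ρ) (substC θ (cond ρ')) (plain⁻ (cond ρ ++ substC θ (cond ρ')) conds)
    c = proj₁ split
    inner : (RootStep _=E_) (σ · (lhs ρ ∣ p)) (σ · (θ · rhs ρ'))
    inner = ρ' , r' , σ ∘ₛ θ , subst ((σ · (lhs ρ ∣ p)) =E_) (·-∘ₛ σ θ (lhs ρ')) overlaps ,
            subst (All Holds) (substC-∘ₛ σ θ (cond ρ')) (proj₂ split) ,
            ·-∘ₛ σ θ (rhs ρ')

  cvp-joinable : LocallyConfluentModE → ∀ π → InCVP π → JoinableModE-ps π
  cvp-joinable lc _ (cvp ρ r x p a x-at-p _) σ (x⟶x' ∷ conds) =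
    lc (σ · lhs ρ) _ (σ · rhs ρ) (ps-instance σ (lhs ρ) p a {var x'} inner)
       (here , step here here ρ r σ refl (plain⁻ (cond ρ) conds))
    where
    x' = suc (mvRule ρ)
    inner : ActiveClosure (RootStep _=E_) (σ · (lhs ρ ∣ p)) (σ x')
    inner = subst (λ s → ActiveClosure (RootStep _=E_) (σ · s) (σ x')) (sym x-at-p) (ps⇒closure x⟶x')

  dcp-joinable : LocallyConfluentModE → ∀ π → InDCP π → JoinableModE-ps π
  dcp-joinable lc _ (dcp ρ r _) σ (h-eq x≐ℓ ∷ (p , _ , x⟶x') ∷ conds) =
    lc (σ (suc (mvRule ρ))) (σ · rhs ρ) _ (ps here here ρ r σ x≐ℓ (plain⁻ (cond ρ) conds)) (p , x⟶x')

  lc⇒joinable : LocallyConfluentModE → AllPairsJoinable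
  lc⇒joinable lc π (inj₁ π∈LCCP)        = lccp-joinable lc π π∈LCCP
  lc⇒joinable lc π (inj₂ (inj₁ π∈CVP)) = cvp-joinable lc π π∈CVP
  lc⇒joinable lc π (inj₂ (inj₂ π∈DCP)) = dcp-joinable lc π π∈DCP

  module _ (joinable : AllPairsJoinable) where

    lccp-peak : ∀ ρ' → R ρ' → ∀ σ' → All Holds (substC σ' (cond ρ')) →
                (p : Pos (lhs ρ')) → Active 𝓡 p → ¬ IsVar (lhs ρ' ∣ p) →
                ∀ {w} → (RootStep _=E_) (σ' · (lhs ρ' ∣ p)) w → Joinable (replaceAt σ' (lhs ρ') p w) (σ' · rhs ρ')
    lccp-peak ρ' r' σ' c' p a nv (ρ , r , σ , e , c , refl) =
      subst₂ Joinable left-instance (extend-rhs ρ' σ' σ)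
        (joinable _ (inj₁ (lccp ρ' ρ r' r p a nv (τ , sat))) τ sat)
      where
      τ = extend ρ' σ' σ
      θ = shift (suc (mvRule ρ'))
      sat : Satisfies τ (lccpPair ρ' ρ p)
      sat = h-eq (subst₂ _=E_ (·-∣ (lhs ρ') p (sym (extend-lhs ρ' σ' σ))) (sym (extend-renamed ρ' σ' σ (lhs ρ))) e)
          ∷ plain⁺ (cond ρ' ++ substC θ (cond ρ))
              (holds-++⁺ (cond ρ') (substC θ (cond ρ))
                (subst (All Holds) (sym (extend-cond ρ' σ' σ)) c')
                (subst (All Holds) (sym (extend-renamedC ρ' σ' σ (cond ρ))) c))
      left-instance : τ · (lhs ρ' [ θ · rhs ρ ]at p) ≡ replaceAt σ' (lhs ρ') p (σ · rhs ρ)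
      left-instance = trans (·-[]at (lhs ρ') p (θ · rhs ρ) (extend-lhs ρ' σ' σ))
                            (cong (replaceAt σ' (lhs ρ') p) (extend-renamed ρ' σ' σ (rhs ρ)))

    cvp-peak : ∀ ρ' → R ρ' → ∀ σ' → All Holds (substC σ' (cond ρ')) →
               (p : Pos (lhs ρ')) → Active 𝓡 p → ∀ x → lhs ρ' ∣ p ≡ var x →
               ∀ {w} → σ' x ⟶ps w → Joinable (replaceAt σ' (lhs ρ') p w) (σ' · rhs ρ')
    cvp-peak ρ' r' σ' c' p a x x-at-p {w} σ'x⟶w =
      subst₂ Joinable left-instance (extend-rhs ρ' σ' b)
        (joinable _ (inj₂ (inj₁ (cvp ρ' r' x p a x-at-p (τ , sat)))) τ sat)
      where
      b : Subst
      b _ = w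
      τ = extend ρ' σ' b
      x' = suc (mvRule ρ')
      τx≡σ'x : τ x ≡ σ' x
      τx≡σ'x = subst (λ s → τ · s ≡ σ' · s) x-at-p (·-∣ (lhs ρ') p (extend-lhs ρ' σ' b))
      sat : Satisfies τ (cvpPair ρ' x p)
      sat = subst₂ _⟶ps_ (sym τx≡σ'x) (sym (extend-fresh ρ' σ' b 0)) σ'x⟶w
          ∷ plain⁺ (cond ρ') (subst (All Holds) (sym (extend-cond ρ' σ' b)) c')
      left-instance : τ · (lhs ρ' [ var x' ]at p) ≡ replaceAt σ' (lhs ρ') p w
      left-instance = trans (·-[]at (lhs ρ') p (var x') (extend-lhs ρ' σ' b))
                            (cong (replaceAt σ' (lhs ρ') p) (extend-fresh ρ' σ' b 0))

    dcp-peak : ∀ {t t' t''} → (RootStep _=E_) t t' → t ⟶inner t'' → Joinable t' t''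
    dcp-peak {t} {t'' = t''} (ρ , r , σ , e , c , refl) t⟶t'' =
      subst₂ Joinable (extend-rhs ρ σ b) (extend-fresh ρ σ b 1)
        (joinable _ (inj₂ (inj₂ (dcp ρ r (τ , sat)))) τ sat)
      where
      b : Subst
      b zero    = t
      b (suc _) = t''
      τ = extend ρ σ b
      sat : Satisfies τ (dcpPair ρ)
      sat = h-eq (subst₂ _=E_ (sym (extend-fresh ρ σ b 0)) (sym (extend-lhs ρ σ b)) e)
          ∷ subst₂ _⟶inner_ (sym (extend-fresh ρ σ b 0)) (sym (extend-fresh ρ σ b 1)) t⟶t''
          ∷ plain⁺ (cond ρ) (subst (All Holds) (sym (extend-cond ρ σ b)) c)

    root-peak : ∀ ρ' → R ρ' → ∀ σ' → All Holds (substC σ' (cond ρ')) →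
                ∀ {w} → ActiveClosure (RootStep _=E_) (σ' · lhs ρ') w → Joinable w (σ' · rhs ρ')
    root-peak ρ' r' σ' c' d with stepInInstance σ' (lhs ρ') d
    ... | atNonVariable p a nv s refl       = lccp-peak ρ' r' σ' c' p a nv s
    ... | belowVariable p a x x-at-p s refl = cvp-peak ρ' r' σ' c' p a x x-at-p s

    peak-joinable : ∀ {t t' t''} → ActiveClosure (RootStep _=E_) t t' → ActiveClosure (RootStep _≡_) t t'' →
                    Joinable t' t''
    peak-joinable d (root (ρ' , r' , σ' , refl , c' , refl)) = root-peak ρ' r' σ' c' d
    peak-joinable (root s) (arg j μj d) = dcp-peak s (arg⇒inner j μj d)
    peak-joinable {fun f ts} (arg i μi dₗ) (arg j μj dᵣ) with i ≟ j
    ... | yes refl = joinable-arg μi ts (peak-joinable dₗ dᵣ)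
    ... | no  i≢j  = joinable-disjoint ts μi μj i≢j (closure⇒ps dₗ) (step⇒ps (closure⇒step dᵣ))

  joinable⇒lc : AllPairsJoinable → LocallyConfluentModE
  joinable⇒lc joinable _ _ _ t⟶t' t⟶t'' = peak-joinable joinable (ps⇒closure t⟶t') (step⇒closure t⟶t'')

-- EqIndependentOfR is what makes the semantics of the paper well defined; here =E,
-- the rewrite steps and Holds are a single inductive definition.
proposition10p14 : (Sg : Signature) (𝓡 : Syntax.EGTRS Sg) →
  Syntax.EqIndependentOfR Sg 𝓡 →
  (Syntax.Semantics.LocallyConfluentModE Sg 𝓡 ⇔
   Syntax.Semantics.AllPairsJoinable Sg 𝓡)
proposition10p14 Sg 𝓡 _ = mk⇔ (lc⇒joinable Sg 𝓡) (joinable⇒lc Sg 𝓡)
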